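{- Let $(\Gamma,t)$ be a linear lambda term with $k$ free variables, $p$ applications and $q$ abstractions. Then its underlying rooted trivalent map $(M,v,e,r,(y_1,\dots,y_k))$ is a rooted trivalent map with boundary of degree $k$ with exactly $p+q$ trivalent vertices.
   Context: Lambda terms are built from variables by application $t(u)$ and abstraction $\lambda x[t]$. A context is a finite ordered list of distinct variables. The relation $\Gamma\vdash t$ is defined inductively by: $x\vdash x$; if $\Gamma\vdash t$ and $\Delta\vdash u$ with $\Gamma,\Delta$ having disjoint variables then $\Gamma,\Delta\vdash t(u)$; if $\Gamma,x\vdash t$ then $\Gamma\vdash\lambda x[t]$; if $\Gamma,y,x,\Delta\vdash t$ then $\Gamma,x,y,\Delta\vdash t$. A linear lambda term is a pair $(\Gamma,t)$ with $\Gamma\vdash t$; the variables of $\Gamma=(x_1,\dots,x_k)$ are its free variables, each occurring exactly once in $t$, and each abstraction binds exactly one occurrence. Let $T=\langle v,e\mid v^3=e^2=1\rangle$. A rooted trivalent map with boundary is a transitive $T$-set $M$ with a distinguished element $r$ and an ordered list of distinct elements $y_1,\dots,y_k$ such that the fixed points of $v$ are exactly $\{r\}$ and the fixed points of $e$ are exactly $\{y_1,\dots,y_k\}$; $k$ is the degree of the boundary; the number of trivalent vertices is the number of $v$-orbits of size $3$. Underlying rooted trivalent map of $(\Gamma,t)$: for each application occurrence in $t$ take three elements $f,a,c$ (function, argument, continuation) with $v(f)=c$, $v(c)=a$, $v(a)=f$; for each abstraction occurrence take three elements $\rho,\pi,\beta$ (root, parameter, body) with $v(\rho)=\pi$, $v(\pi)=\beta$,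 $v(\beta)=\rho$; add one extra element $r$ with $v(r)=r$. Each subterm occurrence $s$ of $t$ has a receiving element: $r$ if $s$ is $t$ itself, the function (resp. argument) element of the application $s'(s'')$ if $s$ is its function part $s'$ (resp. argument part $s''$), and the body element of $\lambda x[s]$ if $s$ is its body. Each subterm occurrence which is not an occurrence of a free variable has a producing element: the continuation element if $s$ is an application, the root element if $s$ is an abstraction, and the parameter element of the abstraction binding $x$ if $s$ is an occurrence of a bound variable $x$. Then $e$ swaps the producing and receiving elements of each such occurrence, and fixes the receiving element of each occurrence of a free variable. The root is $r$ and the boundary is $(y_1,\dots,y_k)$ where $y_i$ is the receiving element of the occurrence of $x_i$. -}

module Defs where

open import Data.Nat using (ℕ; zero; suc; _+_)
open import Data.Nat.Properties using () renaming (_≟_ to _≟ℕ_)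
open import Data.Fin using (Fin; zero; suc)
open import Data.Fin.Properties using () renaming (_≟_ to _≟F_)
open import Data.Empty using (⊥)
open import Data.Maybe using (Maybe; just; nothing)
import Data.Maybe.Properties as MaybeP
open import Data.Sum using (_⊎_; inj₁; inj₂)
import Data.Sum.Properties as SumP
open import Data.Product using (Σ; _×_; _,_; ∃; ∃-syntax)
open import Data.List using (List; []; _∷_; _++_; [_]; map; length)
open import Data.List.Relation.Unary.All using (All)
open import Data.List.Membership.Propositional using (_∈_; _∉_)
open import Data.List.Relation.Unary.Unique.Propositional using (Unique)
open import Function using (_∘_; id; _⇔_)
open import Relation.Nullary using (¬_; yes; no)
open import Relation.Binary.Definitions using (DecidableEquality)
open import Relation.Binary.PropositionalEquality using (_≡_; _≢_)

data Term : Set where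
  var : ℕ → Term
  app : Term → Term → Term
  lam : ℕ → Term → Term

Context : Set
Context = List ℕ

Disjoint : Context → Context → Set
Disjoint Γ Δ = All (λ x → x ∉ Δ) Γ

infix 4 _⊢_
data _⊢_ : Context → Term → Set where
  ⊢var  : ∀ x → [ x ] ⊢ var x
  ⊢app  : ∀ {Γ Δ t u} → Γ ⊢ t → Δ ⊢ u → Disjoint Γ Δ → Γ ++ Δ ⊢ app t u
  ⊢lam  : ∀ {Γ x t} → Γ ++ [ x ] ⊢ t → Γ ⊢ lam x t
  ⊢exch : ∀ {Γ Δ x y t} → Γ ++ y ∷ x ∷ Δ ⊢ t → Γ ++ x ∷ y ∷ Δ ⊢ t

numApp : Term → ℕ
numApp (var x)   = 0
numApp (app t u) = suc (numApp t + numApp u)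
numApp (lam x t) = numApp t

numLam : Term → ℕ
numLam (var x)   = 0
numLam (app t u) = numLam t + numLam u
numLam (lam x t) = suc (numLam t)

-- T = ⟨ v , e ∣ v³ = e² = 1 ⟩ ; group elements are represented by words
data Gen : Set where
  gv ge : Gen

record TMap : Set₁ where
  field
    Carrier  : Set
    v e      : Carrier → Carrier
    root     : Carrier
    boundary : List Carrier

module _ (M : TMap) where
  open TMap M

  act : List Gen → Carrier → Carrier
  act []        m = m
  act (gv ∷ w)  m = v (act w m)
  act (ge ∷ w)  m = e (act w m)

  iter : ℕ → Carrier → Carrier
  iter zero    m = m
  iter (suc n) m = v (iter n m)

  InVOrbit : Carrier → Carrier → Set
  InVOrbit m m' = ∃[ n ] iter n m ≡ m'

  VOrbitSize3 : Carrier → Set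
  VOrbitSize3 m = Σ Carrier λ a → Σ Carrier λ b → Σ Carrier λ c →
    (a ≢ b × a ≢ c × b ≢ c) ×
    (InVOrbit m a × InVOrbit m b × InVOrbit m c) ×
    (∀ x → InVOrbit m x → (x ≡ a ⊎ x ≡ b ⊎ x ≡ c))

  -- the number of v-orbits of size 3 (trivalent vertices) is N:
  -- a bijection between Fin N and the set of size-3 v-orbits
  NumTrivalentVertices : ℕ → Set
  NumTrivalentVertices N = Σ (Fin N → Carrier) λ rep →
    (∀ i → VOrbitSize3 (rep i)) ×
    (∀ i j → InVOrbit (rep i) (rep j) → i ≡ j) ×
    (∀ m → VOrbitSize3 m → ∃[ i ] InVOrbit (rep i) m)

  IsRootedTrivalentMapWithBoundary : Set
  IsRootedTrivalentMapWithBoundary =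
    (∀ m → v (v (v m)) ≡ m) ×
    (∀ m → e (e m) ≡ m) ×
    (∀ m m' → ∃[ w ] act w m ≡ m') ×
    (∀ m → (v m ≡ m) ⇔ (m ≡ root)) ×
    (∀ m → (e m ≡ m) ⇔ (m ∈ boundary)) ×
    Unique boundary

  degree : ℕ
  degree = length boundary

-- Local darts of each application / abstraction occurrence.
-- Application: 0 = function f, 1 = argument a, 2 = continuation c.
-- Abstraction: 0 = root ρ, 1 = parameter π, 2 = body β.
Darts : Term → Set
Darts (var x)   = ⊥
Darts (app t u) = Fin 3 ⊎ (Darts t ⊎ Darts u)
Darts (lam x t) = Fin 3 ⊎ Darts t

-- the carrier: nothing is the extra element r
Elem : Term → Set
Elem t = Maybe (Darts t)

dartsDec : (t : Term) → DecidableEquality (Darts t)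
dartsDec (var x)   = λ ()
dartsDec (app t u) = SumP.≡-dec _≟F_ (SumP.≡-dec (dartsDec t) (dartsDec u))
dartsDec (lam x t) = SumP.≡-dec _≟F_ (dartsDec t)

-- v on local darts: app: f ↦ c ↦ a ↦ f ; lam: ρ ↦ π ↦ β ↦ ρ
rotApp : Fin 3 → Fin 3
rotApp zero             = suc (suc zero)
rotApp (suc (suc zero)) = suc zero
rotApp (suc zero)       = zero

rotLam : Fin 3 → Fin 3
rotLam zero             = suc zero
rotLam (suc zero)       = suc (suc zero)
rotLam (suc (suc zero)) = zero

vDarts : (t : Term) → Darts t → Darts t
vDarts (var x)   ()
vDarts (app t u) (inj₁ i)        = inj₁ (rotApp i)
vDarts (app t u) (inj₂ (inj₁ d)) = inj₂ (inj₁ (vDarts t d))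
vDarts (app t u) (inj₂ (inj₂ d)) = inj₂ (inj₂ (vDarts u d))
vDarts (lam x t) (inj₁ i)        = inj₁ (rotLam i)
vDarts (lam x t) (inj₂ d)        = inj₂ (vDarts t d)

vElem : (t : Term) → Elem t → Elem t
vElem t nothing  = nothing
vElem t (just d) = just (vDarts t d)

fApp aApp cApp ρLam πLam βLam : Fin 3
fApp = zero
aApp = suc zero
cApp = suc (suc zero)
ρLam = zero
πLam = suc zero
βLam = suc (suc zero)

module Traverse {G : Set} where
  Env : Set
  Env = ℕ → Maybe G

  extend : Env → ℕ → G → Env
  extend env x g y with x ≟ℕ y
  ... | yes _ = just g
  ... | no  _ = env y

  -- For the subterm occurrence s (whose darts embed into G via emb),
  -- with receiving element rcv, and env giving the parameter element of
  -- the innermost enclosing abstraction binding each variable: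
  -- the e-edges (receiving , producing) of all non-free-variable
  -- occurrences inside s.
  edges : (s : Term) → (Darts s → G) → G → Env → List (G × G)
  edges (var x) emb rcv env with env x
  ... | just p  = [ (rcv , p) ]
  ... | nothing = []
  edges (app s u) emb rcv env =
    (rcv , emb (inj₁ cApp)) ∷
      (edges s (emb ∘ inj₂ ∘ inj₁) (emb (inj₁ fApp)) env ++
       edges u (emb ∘ inj₂ ∘ inj₂) (emb (inj₁ aApp)) env)
  edges (lam x s) emb rcv env =
    (rcv , emb (inj₁ ρLam)) ∷
      edges s (emb ∘ inj₂) (emb (inj₁ βLam)) (extend env x (emb (inj₁ πLam)))

  freeOccs : (s : Term) → (Darts s → G) → G → Env → List (ℕ × G)
  freeOccs (var x) emb rcv env with env x
  ... | just p  = []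
  ... | nothing = [ (x , rcv) ]
  freeOccs (app s u) emb rcv env =
    freeOccs s (emb ∘ inj₂ ∘ inj₁) (emb (inj₁ fApp)) env ++
    freeOccs u (emb ∘ inj₂ ∘ inj₂) (emb (inj₁ aApp)) env
  freeOccs (lam x s) emb rcv env =
    freeOccs s (emb ∘ inj₂) (emb (inj₁ βLam)) (extend env x (emb (inj₁ πLam)))

open Traverse

allEdges : (t : Term) → List (Elem t × Elem t)
allEdges t = edges t just nothing (λ _ → nothing)

allFreeOccs : (t : Term) → List (ℕ × Elem t)
allFreeOccs t = freeOccs t just nothing (λ _ → nothing)

swapWith : {A : Set} → DecidableEquality A → List (A × A) → A → A
swapWith _≟_ []              m = m
swapWith _≟_ ((a , b) ∷ es) m with m ≟ a | m ≟ b
... | yes _ | _     = b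
... | no _  | yes _ = a
... | no _  | no _  = swapWith _≟_ es m

eElem : (t : Term) → Elem t → Elem t
eElem t = swapWith (MaybeP.≡-dec (dartsDec t)) (allEdges t)

-- receiving element of the occurrence of the free variable x
-- (default r, never used for linear terms)
lookupOcc : {A : Set} → A → ℕ → List (ℕ × A) → A
lookupOcc d x []             = d
lookupOcc d x ((y , a) ∷ os) with x ≟ℕ y
... | yes _ = a
... | no  _ = lookupOcc d x os

underlyingMap : Context → Term → TMap
underlyingMap Γ t = record
  { Carrier  = Elem t
  ; v        = vElem t
  ; e        = eElem t
  ; root     = nothing
  ; boundary = map (λ x → lookupOcc nothing x (allFreeOccs t)) Γ
  }

-- The traversal defining e records every element exactly once: the ends of the edges together
-- with the receiving elements of the free-variable occurrences are a permutation of r and all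
-- darts.  For a subterm this holds relative to its receiving element and to the parameter
-- elements of the enclosing abstractions binding its free variables; linearity makes each such
-- parameter the end of exactly one edge.  Hence e is an involution whose fixed points are the
-- distinct receiving elements of the free variables.  Every application or abstraction node is a
-- v-orbit of three darts, r is the only fixed point of v, and walking along edges and around
-- vertices from r reaches every dart.
module Submission where

open import Defs
open import Data.Empty using (⊥; ⊥-elim)
open import Data.Fin using (Fin; zero; suc)
open import Data.List using (List; []; _∷_; _++_; [_]; map; length; lookup; allFin; mapMaybe; catMaybes)
open import Data.List.Membership.Propositional using (_∈_; _∉_)
open import Data.List.Membership.Propositional.Properties using (∈-map⁺; ∈-map⁻; ∈-++⁺ˡ; ∈-++⁺ʳ; ∈-++⁻; ∈-allFin; ∈-lookup)
import Data.List.Membership.DecPropositional as DecMembership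
open import Data.List.Properties using (map-++; map-∘; length-map; length-++; mapMaybe-++; mapMaybe-nothing; mapMaybe-just; map-cong-local; ++-identityʳ)
open import Data.List.Relation.Binary.Permutation.Propositional using (_↭_; ↭-refl; ↭-sym; ↭-trans; ↭-reflexive; ↭-prep; ↭-swap; ↭⇒↭ₛ; module PermutationReasoning)
open import Data.List.Relation.Binary.Permutation.Propositional.Properties using (∈-resp-↭; ++⁺; ++⁺ˡ; mapMaybe-↭; ++-commutativeMonoid)
import Data.List.Relation.Binary.Permutation.Propositional.Properties as Perm
import Data.List.Relation.Binary.Permutation.Setoid.Properties as PermSetoid
open import Data.List.Relation.Unary.All as All using (All; []; _∷_)
import Data.List.Relation.Unary.All.Properties as All
open import Data.List.Relation.Unary.Any using (here; there; index)
open import Data.List.Relation.Unary.Any.Properties using (lookup-index)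
open import Data.List.Relation.Unary.Unique.Propositional using (Unique; []; _∷_)
import Data.List.Relation.Unary.Unique.Propositional.Properties as Unique
open import Data.Maybe using (Maybe; just; nothing; maybe′)
open import Data.Maybe.Properties using (just-injective)
import Data.Maybe.Properties as Maybe
open import Data.Nat using (ℕ; zero; suc; _+_)
open import Data.Nat.Properties using (+-suc; +-commutativeSemigroup) renaming (_≟_ to _≟ℕ_)
open import Algebra.Properties.CommutativeSemigroup +-commutativeSemigroup using () renaming (interchange to +-interchange)
open import Data.Product using (_×_; _,_; proj₁; proj₂; ∃; ∃-syntax)
open import Data.Sum using (_⊎_; inj₁; inj₂)
open import Data.Sum.Properties using (inj₁-injective; inj₂-injective)
open import Data.Unit using (⊤; tt)
open import Function using (_∘_; id; _⇔_; mk⇔)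
open import Relation.Binary.Definitions using (DecidableEquality)
open import Relation.Binary.PropositionalEquality using (_≡_; _≢_; refl; sym; trans; cong; cong₂; subst; setoid; module ≡-Reasoning)
open import Relation.Nullary using (¬_; yes; no)

open Traverse

Unique-resp-↭ : ∀ {A : Set} {xs ys : List A} → xs ↭ ys → Unique xs → Unique ys
Unique-resp-↭ p = PermSetoid.Unique-resp-↭ (setoid _) (↭⇒↭ₛ p)

Unique-++⁻ : ∀ {A : Set} (xs : List A) {ys} → Unique (xs ++ ys) →
  Unique xs × Unique ys × (∀ {z} → z ∈ xs → z ∉ ys)
Unique-++⁻ []       u         = [] , u , λ ()
Unique-++⁻ (x ∷ xs) (x∉ ∷ u) with Unique-++⁻ xs u
... | uxs , uys , disjoint = All.++⁻ˡ xs x∉ ∷ uxs , uys , λ where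
  (here refl)  z∈ys → All.lookup (All.++⁻ʳ xs x∉) z∈ys refl
  (there z∈xs) z∈ys → disjoint z∈xs z∈ys

lookup-injective : ∀ {A : Set} {xs : List A} → Unique xs → ∀ i j → lookup xs i ≡ lookup xs j → i ≡ j
lookup-injective (_  ∷ _) zero    zero    _  = refl
lookup-injective (x∉ ∷ _) zero    (suc j) eq = ⊥-elim (All.lookup x∉ (∈-lookup j) eq)
lookup-injective (x∉ ∷ _) (suc i) zero    eq = ⊥-elim (All.lookup x∉ (∈-lookup i) (sym eq))
lookup-injective (_  ∷ u) (suc i) (suc j) eq = cong suc (lookup-injective u i j eq)

module _ {A : Set} where
  open import Algebra.Solver.CommutativeMonoid (++-commutativeMonoid {A = A}) using (solve; _⊜_; _⊕_)

  ↭-interchange : ∀ (as bs cs ds : List A) → (as ++ bs) ++ (cs ++ ds) ↭ (as ++ cs) ++ (bs ++ ds)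
  ↭-interchange = solve 4 (λ as bs cs ds → (as ⊕ bs) ⊕ (cs ⊕ ds) ⊜ (as ⊕ cs) ⊕ (bs ⊕ ds)) ↭-refl

  ↭-gather : ∀ (c f a : A) (ds bs du bu : List A) →
    c ∷ (f ∷ ds ++ bs) ++ (a ∷ du ++ bu) ↭ f ∷ a ∷ c ∷ (ds ++ du) ++ (bs ++ bu)
  ↭-gather c f a = solve 7
    (λ c f a ds bs du bu → c ⊕ (f ⊕ ds ⊕ bs) ⊕ (a ⊕ du ⊕ bu) ⊜ f ⊕ a ⊕ c ⊕ (ds ⊕ du) ⊕ (bs ⊕ bu))
    ↭-refl [ c ] [ f ] [ a ]

  ↭-move-last : ∀ (β π : A) (ds bs : List A) → β ∷ ds ++ (bs ++ [ π ]) ↭ π ∷ β ∷ ds ++ bs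
  ↭-move-last β π = solve 4 (λ β π ds bs → β ⊕ ds ⊕ (bs ⊕ π) ⊜ π ⊕ β ⊕ ds ⊕ bs) ↭-refl [ β ] [ π ]

record Enumeration (A : Set) : Set where
  field
    elements : List A
    unique   : Unique elements
    complete : ∀ a → a ∈ elements

open Enumeration

⊥-enumeration : Enumeration ⊥
⊥-enumeration = record { elements = [] ; unique = [] ; complete = λ () }

⊤-enumeration : Enumeration ⊤
⊤-enumeration = record { elements = [ tt ] ; unique = [] ∷ [] ; complete = λ _ → here refl }

Fin-enumeration : ∀ n → Enumeration (Fin n)
Fin-enumeration n = record { elements = allFin n ; unique = Unique.allFin⁺ n ; complete = ∈-allFin }

_⊎-enumeration_ : ∀ {A B : Set} → Enumeration A → Enumeration B → Enumeration (A ⊎ B)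
E ⊎-enumeration F = record
  { elements = map inj₁ (elements E) ++ map inj₂ (elements F)
  ; unique   = Unique.++⁺ (Unique.map⁺ inj₁-injective (unique E)) (Unique.map⁺ inj₂-injective (unique F))
                 inj₁≢inj₂
  ; complete = λ where
      (inj₁ a) → ∈-++⁺ˡ (∈-map⁺ inj₁ (complete E a))
      (inj₂ b) → ∈-++⁺ʳ (map inj₁ (elements E)) (∈-map⁺ inj₂ (complete F b))
  }
  where
  inj₁≢inj₂ : ∀ {z} → ¬ (z ∈ map inj₁ (elements E) × z ∈ map inj₂ (elements F))
  inj₁≢inj₂ (z∈₁ , z∈₂) with ∈-map⁻ inj₁ z∈₁ | ∈-map⁻ inj₂ z∈₂
  ... | _ , _ , refl | _ , _ , ()

Maybe-enumeration : ∀ {A : Set} → Enumeration A → Enumeration (Maybe A)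
Maybe-enumeration E = record
  { elements = nothing ∷ map just (elements E)
  ; unique   = All.tabulate nothing∉ ∷ Unique.map⁺ just-injective (unique E)
  ; complete = λ where
      nothing  → here refl
      (just a) → there (∈-map⁺ just (complete E a))
  }
  where
  nothing∉ : ∀ {z} → z ∈ map just (elements E) → nothing ≢ z
  nothing∉ z∈ with ∈-map⁻ just z∈
  ... | _ , _ , refl = λ ()

module _ {A B : Set} (E : Enumeration A) (F : Enumeration B) where

  length-⊎-enumeration : length (elements (E ⊎-enumeration F)) ≡ length (elements E) + length (elements F)
  length-⊎-enumeration = begin
    length (map inj₁ (elements E) ++ map inj₂ (elements F))
      ≡⟨ length-++ (map inj₁ (elements E)) ⟩
    length (map inj₁ (elements E)) + length (map inj₂ (elements F))
      ≡⟨ cong₂ _+_ (length-map inj₁ (elements E)) (length-map inj₂ (elements F)) ⟩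
    length (elements E) + length (elements F) ∎
    where open ≡-Reasoning

  map-⊎-enumeration : ∀ {C : Set} (f : A ⊎ B → C) →
    map f (elements (E ⊎-enumeration F)) ≡ map (f ∘ inj₁) (elements E) ++ map (f ∘ inj₂) (elements F)
  map-⊎-enumeration f = begin
    map f (map inj₁ (elements E) ++ map inj₂ (elements F))
      ≡⟨ map-++ f (map inj₁ (elements E)) (map inj₂ (elements F)) ⟩
    map f (map inj₁ (elements E)) ++ map f (map inj₂ (elements F))
      ≡⟨ cong₂ _++_ (sym (map-∘ (elements E))) (sym (map-∘ (elements F))) ⟩
    map (f ∘ inj₁) (elements E) ++ map (f ∘ inj₂) (elements F) ∎
    where open ≡-Reasoning

lookup-surjective : ∀ {A : Set} (E : Enumeration A) a → ∃[ i ] lookup (elements E) i ≡ a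
lookup-surjective E a = index (complete E a) , sym (lookup-index (complete E a))

ends : ∀ {A : Set} → List (A × A) → List A
ends []             = []
ends ((a , b) ∷ es) = a ∷ b ∷ ends es

∈-ends⁺ : ∀ {A : Set} (es : List (A × A)) {a b} → (a , b) ∈ es → a ∈ ends es × b ∈ ends es
∈-ends⁺ (_ ∷ es) (here refl) = here refl , there (here refl)
∈-ends⁺ (_ ∷ es) (there ab∈) with ∈-ends⁺ es ab∈
... | a∈ , b∈ = there (there a∈) , there (there b∈)

∈-ends⁻ : ∀ {A : Set} (es : List (A × A)) {m} → m ∈ ends es →
  ∃ λ ab → ab ∈ es × (m ≡ proj₁ ab ⊎ m ≡ proj₂ ab)
∈-ends⁻ (ab ∷ es) (here m≡a)         = ab , here refl , inj₁ m≡a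
∈-ends⁻ (ab ∷ es) (there (here m≡b)) = ab , here refl , inj₂ m≡b
∈-ends⁻ (ab ∷ es) (there (there m∈)) with ∈-ends⁻ es m∈
... | ab′ , ab′∈ , m≡ = ab′ , there ab′∈ , m≡

ends-distinct : ∀ {A : Set} (es : List (A × A)) {a b} → Unique (ends es) → (a , b) ∈ es → a ≢ b
ends-distinct (_ ∷ es) ((a≢b ∷ _) ∷ _) (here refl) = a≢b
ends-distinct (_ ∷ es) (_ ∷ _ ∷ u)     (there ab∈) = ends-distinct es u ab∈

ends-++ : ∀ {A : Set} (es fs : List (A × A)) → ends (es ++ fs) ≡ ends es ++ ends fs
ends-++ []             fs = refl
ends-++ ((a , b) ∷ es) fs = cong (λ xs → a ∷ b ∷ xs) (ends-++ es fs)

module _ {A : Set} (_≟_ : DecidableEquality A) where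

  open DecMembership _≟_ using (_∈?_)

  swapWith-∉ : ∀ es {m} → m ∉ ends es → swapWith _≟_ es m ≡ m
  swapWith-∉ []             _   = refl
  swapWith-∉ ((a , b) ∷ es) {m} m∉ with m ≟ a | m ≟ b
  ... | yes m≡a | _       = ⊥-elim (m∉ (here m≡a))
  ... | no _    | yes m≡b = ⊥-elim (m∉ (there (here m≡b)))
  ... | no _    | no _    = swapWith-∉ es (m∉ ∘ there ∘ there)

  swapWith-skip : ∀ a b es {m} → m ≢ a → m ≢ b → swapWith _≟_ ((a , b) ∷ es) m ≡ swapWith _≟_ es m
  swapWith-skip a b es {m} m≢a m≢b with m ≟ a | m ≟ b
  ... | yes m≡a | _       = ⊥-elim (m≢a m≡a)
  ... | no _    | yes m≡b = ⊥-elim (m≢b m≡b)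
  ... | no _    | no _    = refl

  swapWith-swaps : ∀ es {a b} → Unique (ends es) → (a , b) ∈ es →
    swapWith _≟_ es a ≡ b × swapWith _≟_ es b ≡ a
  swapWith-swaps ((a , b) ∷ es) ((a≢b ∷ _) ∷ _) (here refl) with a ≟ a | b ≟ a | b ≟ b
  ... | no a≢a | _       | _      = ⊥-elim (a≢a refl)
  ... | yes _  | yes b≡a | _      = ⊥-elim (a≢b (sym b≡a))
  ... | yes _  | no _    | no b≢b = ⊥-elim (b≢b refl)
  ... | yes _  | no _    | yes _  = refl , refl
  swapWith-swaps ((a′ , b′) ∷ es) {a} {b} ((_ ∷ a′∉) ∷ b′∉ ∷ u) (there ab∈) =
    trans (skip a∈) (proj₁ (swapWith-swaps es u ab∈)) , trans (skip b∈) (proj₂ (swapWith-swaps es u ab∈))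
    where
    a∈ : a ∈ ends es
    a∈ = proj₁ (∈-ends⁺ es ab∈)
    b∈ : b ∈ ends es
    b∈ = proj₂ (∈-ends⁺ es ab∈)
    skip : ∀ {m} → m ∈ ends es → swapWith _≟_ ((a′ , b′) ∷ es) m ≡ swapWith _≟_ es m
    skip m∈ = swapWith-skip a′ b′ es (All.lookup a′∉ m∈ ∘ sym) (All.lookup b′∉ m∈ ∘ sym)

  module _ (es : List (A × A)) (u : Unique (ends es)) where

    private
      sw : A → A
      sw = swapWith _≟_ es

    swapWith-involutive : ∀ m → sw (sw m) ≡ m
    swapWith-involutive m with m ∈? ends es
    ... | no m∉ = trans (cong sw (swapWith-∉ es m∉)) (swapWith-∉ es m∉)
    ... | yes m∈ with ∈-ends⁻ es m∈
    ... | _ , ab∈ , inj₁ refl = let a↦b , b↦a = swapWith-swaps es u ab∈ in trans (cong sw a↦b) b↦a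
    ... | _ , ab∈ , inj₂ refl = let a↦b , b↦a = swapWith-swaps es u ab∈ in trans (cong sw b↦a) a↦b

    swapWith-fixed⇒∉ : ∀ {m} → sw m ≡ m → m ∉ ends es
    swapWith-fixed⇒∉ fixed m∈ with ∈-ends⁻ es m∈
    ... | _ , ab∈ , inj₁ refl = ends-distinct es u ab∈ (trans (sym fixed) (proj₁ (swapWith-swaps es u ab∈)))
    ... | _ , ab∈ , inj₂ refl = ends-distinct es u ab∈ (trans (sym (proj₂ (swapWith-swaps es u ab∈))) fixed)

data OnTriangle {A : Set} (f : A → A) (a : A) : A → Set where
  at₀ : OnTriangle f a a
  at₁ : OnTriangle f a (f a)
  at₂ : OnTriangle f a (f (f a))

OnTriangle-map : ∀ {A B : Set} {f : A → A} {g : B → B} (h : A → B) → (∀ a → h (f a) ≡ g (h a)) →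
  ∀ {a b} → OnTriangle f a b → OnTriangle g (h a) (h b)
OnTriangle-map                 h h∘f≡g∘h     at₀ = at₀
OnTriangle-map         {g = g} h h∘f≡g∘h {a} at₁ = subst (OnTriangle g (h a)) (sym (h∘f≡g∘h a)) at₁
OnTriangle-map {f = f} {g = g} h h∘f≡g∘h {a} at₂ =
  subst (OnTriangle g (h a)) (sym (trans (h∘f≡g∘h (f a)) (cong g (h∘f≡g∘h a)))) at₂

module _ (M : TMap) where
  open TMap M

  Reachable : Carrier → Carrier → Set
  Reachable m m′ = ∃ λ w → act M w m ≡ m′

  reachable-v : ∀ {m m′} → Reachable m m′ → Reachable m (v m′)
  reachable-v (w , eq) = gv ∷ w , cong v eq

  reachable-e : ∀ {m m′} → Reachable m m′ → Reachable m (e m′)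
  reachable-e (w , eq) = ge ∷ w , cong e eq

  act-++ : ∀ w w′ m → act M (w ++ w′) m ≡ act M w (act M w′ m)
  act-++ []        w′ m = refl
  act-++ (gv ∷ w) w′ m = cong v (act-++ w w′ m)
  act-++ (ge ∷ w) w′ m = cong e (act-++ w w′ m)

  -- v⁻¹ = v² and e⁻¹ = e in T
  inverse : List Gen → List Gen
  inverse []       = []
  inverse (gv ∷ w) = inverse w ++ gv ∷ gv ∷ []
  inverse (ge ∷ w) = inverse w ++ ge ∷ []

  module _ (v³ : ∀ m → v (v (v m)) ≡ m) (e² : ∀ m → e (e m) ≡ m) where

    act-inverse : ∀ w m → act M (inverse w) (act M w m) ≡ m
    act-inverse []       m = refl
    act-inverse (gv ∷ w) m = trans (act-++ (inverse w) (gv ∷ gv ∷ []) _)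
                                   (trans (cong (act M (inverse w)) (v³ _)) (act-inverse w m))
    act-inverse (ge ∷ w) m = trans (act-++ (inverse w) (ge ∷ []) _)
                                   (trans (cong (act M (inverse w)) (e² _)) (act-inverse w m))

    reachable-from⇒transitive : ∀ m₀ → (∀ m → Reachable m₀ m) → ∀ m m′ → Reachable m m′
    reachable-from⇒transitive m₀ reach m m′ with reach m | reach m′
    ... | w , refl | w′ , refl =
      w′ ++ inverse w , trans (act-++ w′ (inverse w) _) (cong (act M w′) (act-inverse w m₀))

  OnTriangle⇒InVOrbit : ∀ {m m′} → OnTriangle v m m′ → InVOrbit M m m′
  OnTriangle⇒InVOrbit at₀ = 0 , refl
  OnTriangle⇒InVOrbit at₁ = 1 , refl
  OnTriangle⇒InVOrbit at₂ = 2 , refl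

  module _ (v³ : ∀ m → v (v (v m)) ≡ m) where

    iter-OnTriangle : ∀ n m → OnTriangle v m (iter M n m)
    iter-OnTriangle zero    m = at₀
    iter-OnTriangle (suc n) m with iter M n m | iter-OnTriangle n m
    ... | _ | at₀ = at₁
    ... | _ | at₁ = at₂
    ... | _ | at₂ = subst (OnTriangle v m) (sym (v³ m)) at₀

    VOrbitSize3-intro : ∀ m → v m ≢ m → VOrbitSize3 M m
    VOrbitSize3-intro m vm≢m =
      m , v m , v (v m) ,
      (m≢vm , m≢v²m , vm≢v²m) ,
      (OnTriangle⇒InVOrbit at₀ , OnTriangle⇒InVOrbit at₁ , OnTriangle⇒InVOrbit at₂) ,
      λ { _ (n , refl) → OnTriangle⇒⊎ (iter-OnTriangle n m) }
      where
      m≢vm : m ≢ v m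
      m≢vm = vm≢m ∘ sym
      m≢v²m : m ≢ v (v m)
      m≢v²m eq = vm≢m (trans (cong v eq) (v³ m))
      vm≢v²m : v m ≢ v (v m)
      vm≢v²m eq = m≢vm (trans (sym (v³ m)) (trans (cong (v ∘ v) eq) (v³ (v m))))
      OnTriangle⇒⊎ : ∀ {m′} → OnTriangle v m m′ → m′ ≡ m ⊎ m′ ≡ v m ⊎ m′ ≡ v (v m)
      OnTriangle⇒⊎ at₀ = inj₁ refl
      OnTriangle⇒⊎ at₁ = inj₂ (inj₁ refl)
      OnTriangle⇒⊎ at₂ = inj₂ (inj₂ refl)

  fixed⇒¬VOrbitSize3 : ∀ m → v m ≡ m → ¬ VOrbitSize3 M m
  fixed⇒¬VOrbitSize3 m vm≡m (_ , _ , _ , (a≢b , _) , ((i , refl) , (j , refl) , _) , _) =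
    a≢b (trans (iter-fixed i) (sym (iter-fixed j)))
    where
    iter-fixed : ∀ n → iter M n m ≡ m
    iter-fixed zero    = refl
    iter-fixed (suc n) = trans (cong v (iter-fixed n)) vm≡m

⊢⇒Unique : ∀ {Γ t} → Γ ⊢ t → Unique Γ
⊢⇒Unique (⊢var x)                  = [] ∷ []
⊢⇒Unique (⊢app ⊢t ⊢u disjoint)     =
  Unique.++⁺ (⊢⇒Unique ⊢t) (⊢⇒Unique ⊢u) (λ (z∈Γ , z∈Δ) → All.lookup disjoint z∈Γ z∈Δ)
⊢⇒Unique (⊢lam {Γ} ⊢t)             = proj₁ (Unique-++⁻ Γ (⊢⇒Unique ⊢t))
⊢⇒Unique (⊢exch {Γ} {x = x} {y} ⊢t) = Unique-resp-↭ (++⁺ˡ Γ (↭-swap y x ↭-refl)) (⊢⇒Unique ⊢t)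

binder-fresh : ∀ {Γ x t} → Γ ++ [ x ] ⊢ t → x ∉ Γ
binder-fresh {Γ} ⊢t x∈Γ = proj₂ (proj₂ (Unique-++⁻ Γ (⊢⇒Unique ⊢t))) x∈Γ (here refl)

Darts-enumeration : ∀ t → Enumeration (Darts t)
Darts-enumeration (var x)   = ⊥-enumeration
Darts-enumeration (app t u) =
  Fin-enumeration 3 ⊎-enumeration (Darts-enumeration t ⊎-enumeration Darts-enumeration u)
Darts-enumeration (lam x t) = Fin-enumeration 3 ⊎-enumeration Darts-enumeration t

vDarts-cube : ∀ t d → vDarts t (vDarts t (vDarts t d)) ≡ d
vDarts-cube (app t u) (inj₁ zero)             = refl
vDarts-cube (app t u) (inj₁ (suc zero))       = refl
vDarts-cube (app t u) (inj₁ (suc (suc zero))) = refl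
vDarts-cube (app t u) (inj₂ (inj₁ d))         = cong (inj₂ ∘ inj₁) (vDarts-cube t d)
vDarts-cube (app t u) (inj₂ (inj₂ d))         = cong (inj₂ ∘ inj₂) (vDarts-cube u d)
vDarts-cube (lam x t) (inj₁ zero)             = refl
vDarts-cube (lam x t) (inj₁ (suc zero))       = refl
vDarts-cube (lam x t) (inj₁ (suc (suc zero))) = refl
vDarts-cube (lam x t) (inj₂ d)                = cong inj₂ (vDarts-cube t d)

vDarts-fixed-free : ∀ t d → vDarts t d ≢ d
vDarts-fixed-free (app t u) (inj₁ zero)             ()
vDarts-fixed-free (app t u) (inj₁ (suc zero))       ()
vDarts-fixed-free (app t u) (inj₁ (suc (suc zero))) ()
vDarts-fixed-free (app t u) (inj₂ (inj₁ d)) eq = vDarts-fixed-free t d (inj₁-injective (inj₂-injective eq))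
vDarts-fixed-free (app t u) (inj₂ (inj₂ d)) eq = vDarts-fixed-free u d (inj₂-injective (inj₂-injective eq))
vDarts-fixed-free (lam x t) (inj₁ zero)             ()
vDarts-fixed-free (lam x t) (inj₁ (suc zero))       ()
vDarts-fixed-free (lam x t) (inj₁ (suc (suc zero))) ()
vDarts-fixed-free (lam x t) (inj₂ d)            eq = vDarts-fixed-free t d (inj₂-injective eq)

Vertex : Term → Set
Vertex (var x)   = ⊥
Vertex (app t u) = ⊤ ⊎ (Vertex t ⊎ Vertex u)
Vertex (lam x t) = ⊤ ⊎ Vertex t

Vertex-enumeration : ∀ t → Enumeration (Vertex t)
Vertex-enumeration (var x)   = ⊥-enumeration
Vertex-enumeration (app t u) =
  ⊤-enumeration ⊎-enumeration (Vertex-enumeration t ⊎-enumeration Vertex-enumeration u)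
Vertex-enumeration (lam x t) = ⊤-enumeration ⊎-enumeration Vertex-enumeration t

length-Vertex-enumeration : ∀ t → length (elements (Vertex-enumeration t)) ≡ numApp t + numLam t
length-Vertex-enumeration (var x)   = refl
length-Vertex-enumeration (app t u) = begin
  length (elements (⊤-enumeration ⊎-enumeration (Vertex-enumeration t ⊎-enumeration Vertex-enumeration u)))
    ≡⟨ length-⊎-enumeration ⊤-enumeration (Vertex-enumeration t ⊎-enumeration Vertex-enumeration u) ⟩
  suc (length (elements (Vertex-enumeration t ⊎-enumeration Vertex-enumeration u)))
    ≡⟨ cong suc (length-⊎-enumeration (Vertex-enumeration t) (Vertex-enumeration u)) ⟩
  suc (length (elements (Vertex-enumeration t)) + length (elements (Vertex-enumeration u)))
    ≡⟨ cong₂ (λ m n → suc (m + n)) (length-Vertex-enumeration t) (length-Vertex-enumeration u) ⟩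
  suc ((numApp t + numLam t) + (numApp u + numLam u))
    ≡⟨ cong suc (+-interchange (numApp t) (numLam t) (numApp u) (numLam u)) ⟩
  suc ((numApp t + numApp u) + (numLam t + numLam u)) ∎
  where open ≡-Reasoning
length-Vertex-enumeration (lam x t) = begin
  length (elements (⊤-enumeration ⊎-enumeration Vertex-enumeration t))
    ≡⟨ length-⊎-enumeration ⊤-enumeration (Vertex-enumeration t) ⟩
  suc (length (elements (Vertex-enumeration t)))
    ≡⟨ cong suc (length-Vertex-enumeration t) ⟩
  suc (numApp t + numLam t)
    ≡⟨ +-suc (numApp t) (numLam t) ⟨
  numApp t + suc (numLam t) ∎
  where open ≡-Reasoning

corner : ∀ t → Vertex t → Darts t
corner (app t u) (inj₁ _)        = inj₁ fApp
corner (app t u) (inj₂ (inj₁ x)) = inj₂ (inj₁ (corner t x))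
corner (app t u) (inj₂ (inj₂ x)) = inj₂ (inj₂ (corner u x))
corner (lam y t) (inj₁ _)        = inj₁ ρLam
corner (lam y t) (inj₂ x)        = inj₂ (corner t x)

vertexOf : ∀ t → Darts t → Vertex t
vertexOf (app t u) (inj₁ _)        = inj₁ tt
vertexOf (app t u) (inj₂ (inj₁ d)) = inj₂ (inj₁ (vertexOf t d))
vertexOf (app t u) (inj₂ (inj₂ d)) = inj₂ (inj₂ (vertexOf u d))
vertexOf (lam y t) (inj₁ _)        = inj₁ tt
vertexOf (lam y t) (inj₂ d)        = inj₂ (vertexOf t d)

vertexOf-corner : ∀ t x → vertexOf t (corner t x) ≡ x
vertexOf-corner (app t u) (inj₁ _)        = refl
vertexOf-corner (app t u) (inj₂ (inj₁ x)) = cong (inj₂ ∘ inj₁) (vertexOf-corner t x)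
vertexOf-corner (app t u) (inj₂ (inj₂ x)) = cong (inj₂ ∘ inj₂) (vertexOf-corner u x)
vertexOf-corner (lam y t) (inj₁ _)        = refl
vertexOf-corner (lam y t) (inj₂ x)        = cong inj₂ (vertexOf-corner t x)

vertexOf-vDarts : ∀ t d → vertexOf t (vDarts t d) ≡ vertexOf t d
vertexOf-vDarts (app t u) (inj₁ _)        = refl
vertexOf-vDarts (app t u) (inj₂ (inj₁ d)) = cong (inj₂ ∘ inj₁) (vertexOf-vDarts t d)
vertexOf-vDarts (app t u) (inj₂ (inj₂ d)) = cong (inj₂ ∘ inj₂) (vertexOf-vDarts u d)
vertexOf-vDarts (lam y t) (inj₁ _)        = refl
vertexOf-vDarts (lam y t) (inj₂ d)        = cong inj₂ (vertexOf-vDarts t d)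

corner-OnTriangle : ∀ t d → OnTriangle (vDarts t) (corner t (vertexOf t d)) d
corner-OnTriangle (app t u) (inj₁ zero)             = at₀
corner-OnTriangle (app t u) (inj₁ (suc zero))       = at₂
corner-OnTriangle (app t u) (inj₁ (suc (suc zero))) = at₁
corner-OnTriangle (app t u) (inj₂ (inj₁ d)) = OnTriangle-map (inj₂ ∘ inj₁) (λ _ → refl) (corner-OnTriangle t d)
corner-OnTriangle (app t u) (inj₂ (inj₂ d)) = OnTriangle-map (inj₂ ∘ inj₂) (λ _ → refl) (corner-OnTriangle u d)
corner-OnTriangle (lam y t) (inj₁ zero)             = at₀
corner-OnTriangle (lam y t) (inj₁ (suc zero))       = at₁
corner-OnTriangle (lam y t) (inj₁ (suc (suc zero))) = at₂
corner-OnTriangle (lam y t) (inj₂ d)        = OnTriangle-map inj₂ (λ _ → refl) (corner-OnTriangle t d)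

vertexOf-OnTriangle : ∀ t {c d} → OnTriangle (vDarts t) c d → vertexOf t d ≡ vertexOf t c
vertexOf-OnTriangle t     at₀ = refl
vertexOf-OnTriangle t {c} at₁ = vertexOf-vDarts t c
vertexOf-OnTriangle t {c} at₂ = trans (vertexOf-vDarts t (vDarts t c)) (vertexOf-vDarts t c)

module _ {G : Set} where

  unbound : Env {G} → ℕ → Maybe ℕ
  unbound env x = maybe′ (λ _ → nothing) (just x) (env x)

  extend-self : ∀ (env : Env {G}) x g → extend env x g x ≡ just g
  extend-self env x g with x ≟ℕ x
  ... | yes _   = refl
  ... | no x≢x = ⊥-elim (x≢x refl)

  extend-other : ∀ (env : Env {G}) x g y → x ≢ y → extend env x g y ≡ env y
  extend-other env x g y x≢y with x ≟ℕ y
  ... | yes x≡y = ⊥-elim (x≢y x≡y)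
  ... | no _    = refl

  mapMaybe-extend-∉ : ∀ {B : Set} (h : ℕ → Maybe G → Maybe B) env x g Δ → x ∉ Δ →
    mapMaybe (λ y → h y (extend env x g y)) Δ ≡ mapMaybe (λ y → h y (env y)) Δ
  mapMaybe-extend-∉ h env x g Δ x∉Δ = cong catMaybes (map-cong-local (All.tabulate λ {y} y∈Δ →
    cong (h y) (extend-other env x g y (λ x≡y → x∉Δ (subst (_∈ Δ) (sym x≡y) y∈Δ)))))

  mapMaybe-extend : ∀ env x g Δ → x ∉ Δ → mapMaybe (extend env x g) (Δ ++ [ x ]) ≡ mapMaybe env Δ ++ [ g ]
  mapMaybe-extend env x g Δ x∉Δ = trans (mapMaybe-++ (extend env x g) Δ [ x ])
    (cong₂ _++_ (mapMaybe-extend-∉ (λ _ m → m) env x g Δ x∉Δ)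
                (cong (λ m → catMaybes [ m ]) (extend-self env x g)))

  mapMaybe-unbound-extend : ∀ env x g Δ → x ∉ Δ →
    mapMaybe (unbound (extend env x g)) (Δ ++ [ x ]) ≡ mapMaybe (unbound env) Δ
  mapMaybe-unbound-extend env x g Δ x∉Δ = begin
    mapMaybe (unbound (extend env x g)) (Δ ++ [ x ])
      ≡⟨ mapMaybe-++ (unbound (extend env x g)) Δ [ x ] ⟩
    mapMaybe (unbound (extend env x g)) Δ ++ mapMaybe (unbound (extend env x g)) [ x ]
      ≡⟨ cong₂ _++_ (mapMaybe-extend-∉ (λ y → maybe′ (λ _ → nothing) (just y)) env x g Δ x∉Δ)
                    (cong (λ m → catMaybes [ maybe′ (λ _ → nothing) (just x) m ]) (extend-self env x g)) ⟩
    mapMaybe (unbound env) Δ ++ []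
      ≡⟨ ++-identityʳ _ ⟩
    mapMaybe (unbound env) Δ ∎
    where open ≡-Reasoning

  freeOccs-vars : ∀ {Δ s} → Δ ⊢ s → ∀ emb rcv (env : Env {G}) →
    map proj₁ (freeOccs s emb rcv env) ↭ mapMaybe (unbound env) Δ
  freeOccs-vars (⊢var x) emb rcv env with env x
  ... | just _  = ↭-refl
  ... | nothing = ↭-refl
  freeOccs-vars (⊢app {Γ} {Δ} {s} {u} ⊢s ⊢u _) emb rcv env = begin
    map proj₁ (Fs ++ Fu)
      ≡⟨ map-++ proj₁ Fs Fu ⟩
    map proj₁ Fs ++ map proj₁ Fu
      ↭⟨ ++⁺ (freeOccs-vars ⊢s _ _ env) (freeOccs-vars ⊢u _ _ env) ⟩
    mapMaybe (unbound env) Γ ++ mapMaybe (unbound env) Δ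
      ≡⟨ mapMaybe-++ (unbound env) Γ Δ ⟨
    mapMaybe (unbound env) (Γ ++ Δ) ∎
    where
    open PermutationReasoning
    Fs = freeOccs s (emb ∘ inj₂ ∘ inj₁) (emb (inj₁ fApp)) env
    Fu = freeOccs u (emb ∘ inj₂ ∘ inj₂) (emb (inj₁ aApp)) env
  freeOccs-vars (⊢lam {Γ} {x} ⊢s) emb rcv env =
    ↭-trans (freeOccs-vars ⊢s _ _ (extend env x π))
            (↭-reflexive (mapMaybe-unbound-extend env x π Γ (binder-fresh ⊢s)))
    where π = emb (inj₁ πLam)
  freeOccs-vars (⊢exch {Γ} {x = x} {y} ⊢s) emb rcv env =
    ↭-trans (freeOccs-vars ⊢s emb rcv env) (mapMaybe-↭ (unbound env) (++⁺ˡ Γ (↭-swap y x ↭-refl)))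

  -- mapMaybe env Δ are the parameter elements of the variables of Δ bound by enclosing
  -- abstractions; each is the producing end of the edge at the occurrence of its variable in s.
  traversal-partition : ∀ {Δ s} → Δ ⊢ s → ∀ (emb : Darts s → G) rcv env →
    ends (edges s emb rcv env) ++ map proj₂ (freeOccs s emb rcv env) ↭
      rcv ∷ map emb (elements (Darts-enumeration s)) ++ mapMaybe env Δ
  traversal-partition (⊢var x) emb rcv env with env x
  ... | just _  = ↭-refl
  ... | nothing = ↭-refl
  traversal-partition (⊢app {Γ} {Δ} {s} {u} ⊢s ⊢u _) emb rcv env = begin
    rcv ∷ c ∷ ends (Es ++ Eu) ++ map proj₂ (Fs ++ Fu)
      ≡⟨ cong₂ (λ xs ys → rcv ∷ c ∷ xs ++ ys) (ends-++ Es Eu) (map-++ proj₂ Fs Fu) ⟩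
    rcv ∷ c ∷ (ends Es ++ ends Eu) ++ (map proj₂ Fs ++ map proj₂ Fu)
      ↭⟨ ↭-prep rcv (↭-prep c (↭-interchange (ends Es) (ends Eu) (map proj₂ Fs) (map proj₂ Fu))) ⟩
    rcv ∷ c ∷ (ends Es ++ map proj₂ Fs) ++ (ends Eu ++ map proj₂ Fu)
      ↭⟨ ↭-prep rcv (↭-prep c (++⁺ (traversal-partition ⊢s _ f env) (traversal-partition ⊢u _ a env))) ⟩
    rcv ∷ c ∷ (f ∷ Ds ++ mapMaybe env Γ) ++ (a ∷ Du ++ mapMaybe env Δ)
      ↭⟨ ↭-prep rcv (↭-gather c f a Ds (mapMaybe env Γ) Du (mapMaybe env Δ)) ⟩
    rcv ∷ f ∷ a ∷ c ∷ (Ds ++ Du) ++ (mapMaybe env Γ ++ mapMaybe env Δ)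
      ≡⟨ cong₂ (λ xs ys → rcv ∷ xs ++ ys) darts (mapMaybe-++ env Γ Δ) ⟨
    rcv ∷ map emb (elements (Darts-enumeration (app s u))) ++ mapMaybe env (Γ ++ Δ) ∎
    where
    open PermutationReasoning
    f = emb (inj₁ fApp)
    a = emb (inj₁ aApp)
    c = emb (inj₁ cApp)
    Es = edges s (emb ∘ inj₂ ∘ inj₁) f env
    Eu = edges u (emb ∘ inj₂ ∘ inj₂) a env
    Fs = freeOccs s (emb ∘ inj₂ ∘ inj₁) f env
    Fu = freeOccs u (emb ∘ inj₂ ∘ inj₂) a env
    Ds = map (emb ∘ inj₂ ∘ inj₁) (elements (Darts-enumeration s))
    Du = map (emb ∘ inj₂ ∘ inj₂) (elements (Darts-enumeration u))
    darts : map emb (elements (Darts-enumeration (app s u))) ≡ f ∷ a ∷ c ∷ (Ds ++ Du)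
    darts = trans
      (map-⊎-enumeration (Fin-enumeration 3) (Darts-enumeration s ⊎-enumeration Darts-enumeration u) emb)
      (cong (λ xs → f ∷ a ∷ c ∷ xs) (map-⊎-enumeration (Darts-enumeration s) (Darts-enumeration u) (emb ∘ inj₂)))
  traversal-partition (⊢lam {Γ} {x} {s} ⊢s) emb rcv env = begin
    rcv ∷ ρ ∷ ends Es ++ map proj₂ Fs
      ↭⟨ ↭-prep rcv (↭-prep ρ (traversal-partition ⊢s _ β env′)) ⟩
    rcv ∷ ρ ∷ β ∷ Ds ++ mapMaybe env′ (Γ ++ [ x ])
      ≡⟨ cong (λ bs → rcv ∷ ρ ∷ β ∷ Ds ++ bs) (mapMaybe-extend env x π Γ (binder-fresh ⊢s)) ⟩
    rcv ∷ ρ ∷ β ∷ Ds ++ (mapMaybe env Γ ++ [ π ])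
      ↭⟨ ↭-prep rcv (↭-prep ρ (↭-move-last β π Ds (mapMaybe env Γ))) ⟩
    rcv ∷ ρ ∷ π ∷ β ∷ Ds ++ mapMaybe env Γ
      ≡⟨ cong (λ ds → rcv ∷ ds ++ mapMaybe env Γ)
              (map-⊎-enumeration (Fin-enumeration 3) (Darts-enumeration s) emb) ⟨
    rcv ∷ map emb (elements (Darts-enumeration (lam x s))) ++ mapMaybe env Γ ∎
    where
    open PermutationReasoning
    ρ = emb (inj₁ ρLam)
    π = emb (inj₁ πLam)
    β = emb (inj₁ βLam)
    env′ = extend env x π
    Es = edges s (emb ∘ inj₂) β env′
    Fs = freeOccs s (emb ∘ inj₂) β env′
    Ds = map (emb ∘ inj₂) (elements (Darts-enumeration s))
  traversal-partition (⊢exch {Γ} {x = x} {y} ⊢s) emb rcv env =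
    ↭-trans (traversal-partition ⊢s emb rcv env)
            (↭-prep rcv (++⁺ˡ _ (mapMaybe-↭ env (++⁺ˡ Γ (↭-swap y x ↭-refl)))))

module _ {A : Set} (default : A) where

  lookupOcc-here : ∀ x a os → lookupOcc default x ((x , a) ∷ os) ≡ a
  lookupOcc-here x a os with x ≟ℕ x
  ... | yes _   = refl
  ... | no x≢x = ⊥-elim (x≢x refl)

  lookupOcc-there : ∀ x y a os → x ≢ y → lookupOcc default x ((y , a) ∷ os) ≡ lookupOcc default x os
  lookupOcc-there x y a os x≢y with x ≟ℕ y
  ... | yes x≡y = ⊥-elim (x≢y x≡y)
  ... | no _    = refl

  lookupOcc-keys : ∀ (os : List (ℕ × A)) → Unique (map proj₁ os) →
    map (λ x → lookupOcc default x os) (map proj₁ os) ≡ map proj₂ os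
  lookupOcc-keys []             _          = refl
  lookupOcc-keys ((y , a) ∷ os) (y∉ ∷ u) = cong₂ _∷_ (lookupOcc-here y a os) (trans
    (map-cong-local (All.map (λ {x} y≢x → lookupOcc-there x y a os (y≢x ∘ sym)) y∉))
    (lookupOcc-keys os u))

module UnderlyingMap {Γ : Context} {t : Term} (⊢t : Γ ⊢ t) where

  M : TMap
  M = underlyingMap Γ t

  open TMap M

  private
    _≟_ : DecidableEquality (Elem t)
    _≟_ = Maybe.≡-dec (dartsDec t)

    E : List (Elem t × Elem t)
    E = allEdges t

    F : List (ℕ × Elem t)
    F = allFreeOccs t

    empty : Env {Elem t}
    empty _ = nothing

  Elem-enumeration : Enumeration (Elem t)
  Elem-enumeration = Maybe-enumeration (Darts-enumeration t)

  ends++occs↭elements : ends E ++ map proj₂ F ↭ elements Elem-enumeration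
  ends++occs↭elements = begin
    ends E ++ map proj₂ F                       ↭⟨ traversal-partition ⊢t just nothing empty ⟩
    nothing ∷ darts ++ mapMaybe empty Γ         ≡⟨ cong (λ xs → nothing ∷ darts ++ xs) (mapMaybe-nothing Γ) ⟩
    nothing ∷ darts ++ []                       ≡⟨ cong (nothing ∷_) (++-identityʳ darts) ⟩
    nothing ∷ darts                             ∎
    where
    open PermutationReasoning
    darts = map just (elements (Darts-enumeration t))

  ends++occs-unique : Unique (ends E ++ map proj₂ F)
  ends++occs-unique = Unique-resp-↭ (↭-sym ends++occs↭elements) (unique Elem-enumeration)

  ends-unique : Unique (ends E)
  ends-unique = proj₁ (Unique-++⁻ (ends E) ends++occs-unique)

  occs-unique : Unique (map proj₂ F)
  occs-unique = proj₁ (proj₂ (Unique-++⁻ (ends E) ends++occs-unique))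

  ends-∉-occs : ∀ {m} → m ∈ ends E → m ∉ map proj₂ F
  ends-∉-occs = proj₂ (proj₂ (Unique-++⁻ (ends E) ends++occs-unique))

  boundary↭occs : boundary ↭ map proj₂ F
  boundary↭occs = begin
    map lk Γ              ↭⟨ Perm.map⁺ lk (↭-sym keys↭Γ) ⟩
    map lk (map proj₁ F)  ≡⟨ lookupOcc-keys nothing F (Unique-resp-↭ (↭-sym keys↭Γ) (⊢⇒Unique ⊢t)) ⟩
    map proj₂ F           ∎
    where
    open PermutationReasoning
    lk : ℕ → Elem t
    lk x = lookupOcc nothing x F
    keys↭Γ : map proj₁ F ↭ Γ
    keys↭Γ = ↭-trans (freeOccs-vars ⊢t just nothing empty) (↭-reflexive (mapMaybe-just Γ))

  e-involutive : ∀ m → e (e m) ≡ m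
  e-involutive = swapWith-involutive _≟_ E ends-unique

  e-fixed⇔boundary : ∀ m → (e m ≡ m) ⇔ (m ∈ boundary)
  e-fixed⇔boundary m = mk⇔ fixed⇒boundary boundary⇒fixed
    where
    fixed⇒boundary : e m ≡ m → m ∈ boundary
    fixed⇒boundary fixed
      with ∈-++⁻ (ends E) (∈-resp-↭ (↭-sym ends++occs↭elements) (complete Elem-enumeration m))
    ... | inj₁ m∈ends = ⊥-elim (swapWith-fixed⇒∉ _≟_ E ends-unique fixed m∈ends)
    ... | inj₂ m∈occs = ∈-resp-↭ (↭-sym boundary↭occs) m∈occs
    boundary⇒fixed : m ∈ boundary → e m ≡ m
    boundary⇒fixed m∈ = swapWith-∉ _≟_ E λ m∈ends → ends-∉-occs m∈ends (∈-resp-↭ boundary↭occs m∈)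

  boundary-unique : Unique boundary
  boundary-unique = Unique-resp-↭ (↭-sym boundary↭occs) occs-unique

  v³ : ∀ m → v (v (v m)) ≡ m
  v³ nothing  = refl
  v³ (just d) = cong just (vDarts-cube t d)

  v-fixed⇔root : ∀ m → (v m ≡ m) ⇔ (m ≡ root)
  v-fixed⇔root nothing  = mk⇔ (λ _ → refl) (λ _ → refl)
  v-fixed⇔root (just d) = mk⇔ (⊥-elim ∘ vDarts-fixed-free t d ∘ just-injective) λ ()

  along-edge : ∀ {a b} → (a , b) ∈ E → Reachable M root a → Reachable M root b
  along-edge ab∈ r =
    subst (Reachable M root) (proj₁ (swapWith-swaps _≟_ E ends-unique ab∈)) (reachable-e M r)

  reachable : ∀ s (emb : Darts s → Elem t) rcv env → (∀ {p} → p ∈ edges s emb rcv env → p ∈ E) →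
    (∀ d → v (emb d) ≡ emb (vDarts s d)) → Reachable M root rcv → ∀ d → Reachable M root (emb d)
  reachable (app s u) emb rcv env edges⊆E emb-v r = reach
    where
    r-c : Reachable M root (emb (inj₁ cApp))
    r-c = along-edge (edges⊆E (here refl)) r
    r-a : Reachable M root (emb (inj₁ aApp))
    r-a = subst (Reachable M root) (emb-v (inj₁ cApp)) (reachable-v M r-c)
    r-f : Reachable M root (emb (inj₁ fApp))
    r-f = subst (Reachable M root) (emb-v (inj₁ aApp)) (reachable-v M r-a)
    reach : ∀ d → Reachable M root (emb d)
    reach (inj₁ zero)             = r-f
    reach (inj₁ (suc zero))       = r-a
    reach (inj₁ (suc (suc zero))) = r-c
    reach (inj₂ (inj₁ d)) = reachable s _ _ env (edges⊆E ∘ there ∘ ∈-++⁺ˡ) (emb-v ∘ inj₂ ∘ inj₁) r-f d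
    reach (inj₂ (inj₂ d)) = reachable u _ _ env (edges⊆E ∘ there ∘ ∈-++⁺ʳ _) (emb-v ∘ inj₂ ∘ inj₂) r-a d
  reachable (lam x s) emb rcv env edges⊆E emb-v r = reach
    where
    r-ρ : Reachable M root (emb (inj₁ ρLam))
    r-ρ = along-edge (edges⊆E (here refl)) r
    r-π : Reachable M root (emb (inj₁ πLam))
    r-π = subst (Reachable M root) (emb-v (inj₁ ρLam)) (reachable-v M r-ρ)
    r-β : Reachable M root (emb (inj₁ βLam))
    r-β = subst (Reachable M root) (emb-v (inj₁ πLam)) (reachable-v M r-π)
    reach : ∀ d → Reachable M root (emb d)
    reach (inj₁ zero)             = r-ρ
    reach (inj₁ (suc zero))       = r-π
    reach (inj₁ (suc (suc zero))) = r-β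
    reach (inj₂ d) = reachable s _ _ _ (edges⊆E ∘ there) (emb-v ∘ inj₂) r-β d

  all-reachable : ∀ m → Reachable M root m
  all-reachable nothing  = [] , refl
  all-reachable (just d) = reachable t just nothing empty id (λ _ → refl) ([] , refl) d

  isRootedTrivalentMapWithBoundary : IsRootedTrivalentMapWithBoundary M
  isRootedTrivalentMapWithBoundary =
    v³ , e-involutive , reachable-from⇒transitive M v³ e-involutive root all-reachable ,
    v-fixed⇔root , e-fixed⇔boundary , boundary-unique

  OnTriangle-just⁻ : ∀ {c d} → OnTriangle v (just c) (just d) → OnTriangle (vDarts t) c d
  OnTriangle-just⁻ at₀ = at₀
  OnTriangle-just⁻ at₁ = at₁
  OnTriangle-just⁻ at₂ = at₂

  trivalentVertices : NumTrivalentVertices M (length (elements (Vertex-enumeration t)))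
  trivalentVertices =
    rep , (λ i → VOrbitSize3-intro M v³ (rep i) (vDarts-fixed-free t _ ∘ just-injective)) ,
    rep-injective , rep-surjective
    where
    vertices = elements (Vertex-enumeration t)

    rep : Fin (length vertices) → Elem t
    rep i = just (corner t (lookup vertices i))

    rep-injective : ∀ i j → InVOrbit M (rep i) (rep j) → i ≡ j
    rep-injective i j (n , iterⁿ≡) = lookup-injective (unique (Vertex-enumeration t)) i j (begin
      lookup vertices i                           ≡⟨ vertexOf-corner t (lookup vertices i) ⟨
      vertexOf t (corner t (lookup vertices i))   ≡⟨ vertexOf-OnTriangle t (OnTriangle-just⁻ triangle) ⟨
      vertexOf t (corner t (lookup vertices j))   ≡⟨ vertexOf-corner t (lookup vertices j) ⟩
      lookup vertices j                           ∎)
      where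
      open ≡-Reasoning
      triangle : OnTriangle v (rep i) (rep j)
      triangle = subst (OnTriangle v (rep i)) iterⁿ≡ (iter-OnTriangle M v³ n (rep i))

    rep-surjective : ∀ m → VOrbitSize3 M m → ∃[ i ] InVOrbit M (rep i) m
    rep-surjective nothing  size3 = ⊥-elim (fixed⇒¬VOrbitSize3 M nothing refl size3)
    rep-surjective (just d) _ with lookup-surjective (Vertex-enumeration t) (vertexOf t d)
    ... | i , lookup≡ = i , OnTriangle⇒InVOrbit M (OnTriangle-map just (λ _ → refl)
      (subst (λ x → OnTriangle (vDarts t) (corner t x) d) (sym lookup≡) (corner-OnTriangle t d)))

proposition2 : ∀ {Γ t} → Γ ⊢ t →
    IsRootedTrivalentMapWithBoundary (underlyingMap Γ t) ×
    degree (underlyingMap Γ t) ≡ length Γ ×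
    NumTrivalentVertices (underlyingMap Γ t) (numApp t + numLam t)
proposition2 {Γ} {t} ⊢t =
  isRootedTrivalentMapWithBoundary ,
  length-map _ Γ ,
  subst (NumTrivalentVertices M) (length-Vertex-enumeration t) trivalentVertices
  where open UnderlyingMap ⊢t
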